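{- Let $I=(h_1\ge h_2\ge\dots\ge h_n>0)$ be an instance of discrete BGT with $H=\sum_{i=1}^n h_i$, and let $\delta>0$. Let $\langle f_1,\dots,f_n\rangle$ be any sequence of positive integers with $f_i\le (1+\delta)H/h_i$ for every $i$. If this Pinwheel instance $\langle f_1,\dots,f_n\rangle$ is feasible, then every feasible Pinwheel schedule $S$ of it, used as a trimming schedule for $I$, satisfies $\mathit{MH}(S)\le (1+\delta)\,\mathit{OPT}(I)$, i.e. it is a $(1+\delta)$-approximation schedule for $I$.
   Context: Discrete Bamboo Garden Trimming (BGT): there are $n\ge 2$ bamboos $b_1,\dots,b_n$ with daily growth rates $h_1\ge\dots\ge h_n>0$, all of initial height $0$. A (perpetual trimming) schedule is an infinite sequence $(i_1,i_2,\dots)$ of indices in $\{1,\dots,n\}$; at the end of day $t$ the bamboo $b_{i_t}$ is cut instantaneously to height $0$ (exactly one bamboo is cut per day). The height of $b_i$ at time $t\ge0$ is $(t-t')h_i$ where $t'$ is the last time $b_i$ was cut ($t'=0$ if never). For a schedule $S$, $\mathit{MH}(S)$ is the supremum over all times of the heights of all bamboos, and $\mathit{OPT}(I)$ is the infimum of $\mathit{MH}(S)$ over all schedules $S$ for $I$. Pinwheel: given positive integers $f_1,\dots,f_n$ (frequencies), a schedule is an infinite sequence over $\{1,\dots,n\}$ such that for each $i$, every block of $f_i$ consecutive entries contains $i$; the instance is feasible if such a sequence exists.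
   Formalization: The growth rates $h_i$ and δ are rational, and the upper bounds on heights against which $\mathit{OPT}(I)$ is taken range over the rationals as well. -}

module Defs where

open import Data.Nat as ℕ using (ℕ; zero; suc)
open import Data.Fin using (Fin; zero; suc; _≟_)
open import Data.Rational using (ℚ; 0ℚ; 1ℚ; _+_; _*_; _≤_; _<_; _/_)
open import Data.Integer using (+_)
open import Data.Product using (∃; _×_)
open import Relation.Binary.PropositionalEquality using (_≡_)
open import Relation.Nullary using (yes; no)

-- A BGT instance: n growth rates h : Fin n → ℚ.
-- A (perpetual) schedule: s : ℕ → Fin n ; s k is the bamboo cut at the
-- end of day k+1 (days are numbered 1,2,…).
Schedule : ℕ → Set
Schedule n = ℕ → Fin n

ℕtoℚ : ℕ → ℚ
ℕtoℚ k = (+ k) / 1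

sumℚ : ∀ {n} → (Fin n → ℚ) → ℚ
sumℚ {zero}  h = 0ℚ
sumℚ {suc n} h = h zero + sumℚ (λ i → h (suc i))

-- since s i t = number of days elapsed at time t (end of day t, after
-- that day's cut) since bamboo i was last cut (0 if never cut: t - 0).
since : ∀ {n} → Schedule n → Fin n → ℕ → ℕ
since s i zero = zero
since s i (suc t) with s t ≟ i
... | yes _ = zero
... | no  _ = suc (since s i t)

-- Heights only increase between cuts, so the supremum of all heights
-- over all (real) times equals the supremum of the heights reached just
-- before the cuts at the ends of days t+1, namely (since s i t + 1) * h_i.
-- "MH(S) ≤ x" : x is an upper bound of all heights of all bamboos.
MH≤ : ∀ {n} → (Fin n → ℚ) → Schedule n → ℚ → Set
MH≤ h s x = ∀ i t → (ℕtoℚ (suc (since s i t))) * h i ≤ x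

-- "MH(S) ≤ c · OPT(I)" where OPT(I) = inf_S' MH(S').  Since c > 0 and
-- MH(S') = least upper bound of the heights of S', this holds iff for
-- every schedule S' and every upper bound x of the heights of S',
-- MH(S) ≤ c · x.
MH≤c*OPT : ∀ {n} → (Fin n → ℚ) → Schedule n → ℚ → Set
MH≤c*OPT {n} h s c = ∀ (s' : Schedule n) (x : ℚ) → MH≤ h s' x → MH≤ h s (c * x)

PinwheelSchedule : ∀ {n} → (Fin n → ℕ) → Schedule n → Set
PinwheelSchedule f s = ∀ i k → ∃ λ j → (j ℕ.< f i) × (s (k ℕ.+ j) ≡ i)

-- Lower bound OPT ≥ H: if no height ever exceeds x, the total height of the garden stays below
-- n x, yet each day it grows by H while the single cut removes at most x; over many days this
-- forces H ≤ x.  Upper bound: in a Pinwheel schedule each b_i is cut at least every f_i days, so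
-- its height never exceeds f_i h_i ≤ (1 + δ) H ≤ (1 + δ) OPT.
module Submission where

open import Defs
open import Data.Nat as ℕ using (ℕ; zero; suc)
import Data.Nat.Properties as ℕ
import Data.Nat.Coprimality as Coprime
open import Data.Integer as ℤ using (+_; -[1+_])
import Data.Integer.Properties as ℤ
open import Data.Fin as F using (Fin)
import Data.Fin.Properties as F
open import Data.Product using (∃; _,_; proj₁; proj₂)
open import Data.Sum using (inj₁; inj₂)
open import Data.Empty using (⊥-elim)
open import Data.Rational
open import Data.Rational.Properties
open import Data.Rational.Solver using (module +-*-Solver)
open import Relation.Binary.PropositionalEquality
open import Function using (_∘_)
open import Relation.Nullary using (yes; no; contradiction)
open +-*-Solver

ℕtoℚ≡mkℚ : ∀ k → ℕtoℚ k ≡ mkℚ (+ k) 0 (Coprime.sym (Coprime.1-coprimeTo k))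
ℕtoℚ≡mkℚ k = normalize-coprime (Coprime.sym (Coprime.1-coprimeTo k))

ℕtoℚ-+ : ∀ m n → ℕtoℚ (m ℕ.+ n) ≡ ℕtoℚ m + ℕtoℚ n
ℕtoℚ-+ m n rewrite ℕtoℚ≡mkℚ m | ℕtoℚ≡mkℚ n =
  /-cong (cong₂ ℤ._+_ (sym (ℤ.*-identityʳ (+ m))) (sym (ℤ.*-identityʳ (+ n)))) refl

ℕtoℚ-suc-* : ∀ k q → ℕtoℚ (suc k) * q ≡ ℕtoℚ k * q + q
ℕtoℚ-suc-* k q rewrite ℕtoℚ-+ 1 k = solve 2 (λ k q → (con 1ℚ :+ k) :* q := k :* q :+ q) refl (ℕtoℚ k) q

ℕtoℚ-nonNeg : ∀ k → 0ℚ ≤ ℕtoℚ k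
ℕtoℚ-nonNeg k = nonNegative⁻¹ (ℕtoℚ k) {{normalize-nonNeg k 1}}

ℕtoℚ-mono-≤ : ∀ {m n} → m ℕ.≤ n → ℕtoℚ m ≤ ℕtoℚ n
ℕtoℚ-mono-≤ {m} m≤n with ℕ.m≤n⇒∃[o]m+o≡n m≤n
... | k , refl = begin
  ℕtoℚ m               ≡⟨ +-identityʳ (ℕtoℚ m) ⟨
  ℕtoℚ m + 0ℚ          ≤⟨ +-monoʳ-≤ (ℕtoℚ m) (ℕtoℚ-nonNeg k) ⟩
  ℕtoℚ m + ℕtoℚ k      ≡⟨ ℕtoℚ-+ m k ⟨
  ℕtoℚ (m ℕ.+ k)       ∎
  where open ≤-Reasoning

ℕtoℚ-unbounded : ∀ q → ∃ λ m → q < ℕtoℚ m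
ℕtoℚ-unbounded q@(mkℚ i d _) =
  suc ℤ.∣ i ∣ , subst (q <_) (sym (ℕtoℚ≡mkℚ (suc ℤ.∣ i ∣))) (*<* (begin-strict
  i ℤ.* + 1                    ≡⟨ ℤ.*-identityʳ i ⟩
  i                            <⟨ i<1+∣i∣ i ⟩
  + suc ℤ.∣ i ∣                ≤⟨ ℤ.+≤+ (ℕ.m≤m*n (suc ℤ.∣ i ∣) (suc d)) ⟩
  + (suc ℤ.∣ i ∣ ℕ.* suc d)    ≡⟨ ℤ.pos-* (suc ℤ.∣ i ∣) (suc d) ⟩
  + suc ℤ.∣ i ∣ ℤ.* + suc d    ∎))
  where
  open ℤ.≤-Reasoning
  i<1+∣i∣ : ∀ i → i ℤ.< + suc ℤ.∣ i ∣
  i<1+∣i∣ (+ k)    = ℤ.+<+ ℕ.≤-refl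
  i<1+∣i∣ -[1+ k ] = ℤ.-<+

archimedean : ∀ {a b} c → (∀ t → ℕtoℚ t * a ≤ ℕtoℚ t * b + c) → a ≤ b
archimedean {a} {b} c bounded with a ≤? b
... | yes a≤b = a≤b
... | no  a≰b = ⊥-elim (<-irrefl refl (≤-<-trans (bounded t) tb+c<ta))
  where
  d = a - b
  instance
    d-pos : Positive d
    d-pos = positive (subst (_< d) (+-inverseʳ b) (+-monoˡ-< (- b) (≰⇒> a≰b)))
    d-nonZero : NonZero d
    d-nonZero = pos⇒nonZero d
  c÷d<t = proj₂ (ℕtoℚ-unbounded (c ÷ d))
  t = proj₁ (ℕtoℚ-unbounded (c ÷ d))
  c÷d*d≡c : c ÷ d * d ≡ c
  c÷d*d≡c = begin-equality
    c * 1/ d * d    ≡⟨ *-assoc c (1/ d) d ⟩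
    c * (1/ d * d)  ≡⟨ cong (c *_) (*-inverseˡ d) ⟩
    c * 1ℚ          ≡⟨ *-identityʳ c ⟩
    c               ∎
    where open ≤-Reasoning
  c<td : c < ℕtoℚ t * d
  c<td = subst (_< ℕtoℚ t * d) c÷d*d≡c (*-monoˡ-<-pos d c÷d<t)
  tb+c<ta : ℕtoℚ t * b + c < ℕtoℚ t * a
  tb+c<ta = begin-strict
    ℕtoℚ t * b + c             <⟨ +-monoʳ-< (ℕtoℚ t * b) c<td ⟩
    ℕtoℚ t * b + ℕtoℚ t * d    ≡⟨ solve 3 (λ t a b → t :* b :+ t :* (a :- b) := t :* a) refl (ℕtoℚ t) a b ⟩
    ℕtoℚ t * a                 ∎
    where open ≤-Reasoning

sumℚ-cong : ∀ {n} {a b : Fin n → ℚ} → a ≗ b → sumℚ a ≡ sumℚ b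
sumℚ-cong {zero}  a≗b = refl
sumℚ-cong {suc n} a≗b = cong₂ _+_ (a≗b F.zero) (sumℚ-cong (λ i → a≗b (F.suc i)))

sumℚ-+ : ∀ {n} (a b : Fin n → ℚ) → sumℚ (λ i → a i + b i) ≡ sumℚ a + sumℚ b
sumℚ-+ {zero}  a b = refl
sumℚ-+ {suc n} a b
  rewrite sumℚ-+ (λ i → a (F.suc i)) (λ i → b (F.suc i)) =
  solve 4 (λ a₀ b₀ A B → (a₀ :+ b₀) :+ (A :+ B) := (a₀ :+ A) :+ (b₀ :+ B)) refl
    (a F.zero) (b F.zero) (sumℚ (λ i → a (F.suc i))) (sumℚ (λ i → b (F.suc i)))

sumℚ-const : ∀ n x → sumℚ {n} (λ _ → x) ≡ ℕtoℚ n * x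
sumℚ-const zero    x = sym (*-zeroˡ x)
sumℚ-const (suc n) x rewrite sumℚ-const n x | ℕtoℚ-suc-* n x = +-comm x (ℕtoℚ n * x)

sumℚ-mono-≤ : ∀ {n} {a b : Fin n → ℚ} → (∀ i → a i ≤ b i) → sumℚ a ≤ sumℚ b
sumℚ-mono-≤ {zero}  a≤b = ≤-refl
sumℚ-mono-≤ {suc n} a≤b = +-mono-≤ (a≤b F.zero) (sumℚ-mono-≤ (λ i → a≤b (F.suc i)))

sumℚ-nonNeg : ∀ {n} {a : Fin n → ℚ} → (∀ i → 0ℚ ≤ a i) → 0ℚ ≤ sumℚ a
sumℚ-nonNeg {zero}  a≥0 = ≤-refl
sumℚ-nonNeg {suc n} a≥0 = +-mono-≤ (a≥0 F.zero) (sumℚ-nonNeg (λ i → a≥0 (F.suc i)))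

sumℚ-update : ∀ {n} (j : Fin n) {a b : Fin n → ℚ} → (∀ i → i ≢ j → a i ≡ b i) →
              sumℚ a + b j ≡ sumℚ b + a j
sumℚ-update F.zero {a} {b} a≗b
  rewrite sumℚ-cong {a = λ i → a (F.suc i)} {b = λ i → b (F.suc i)} (λ i → a≗b (F.suc i) λ ()) =
  solve 3 (λ a₀ b₀ B → (a₀ :+ B) :+ b₀ := (b₀ :+ B) :+ a₀) refl
    (a F.zero) (b F.zero) (sumℚ (λ i → b (F.suc i)))
sumℚ-update (F.suc j) {a} {b} a≗b
  rewrite a≗b F.zero (λ ()) = begin-equality
  (b₀ + A) + b (F.suc j)   ≡⟨ +-assoc b₀ A (b (F.suc j)) ⟩
  b₀ + (A + b (F.suc j))   ≡⟨ cong (_+_ b₀) (sumℚ-update j (λ i i≢j → a≗b (F.suc i) (i≢j ∘ F.suc-injective))) ⟩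
  b₀ + (B + a (F.suc j))   ≡⟨ +-assoc b₀ B (a (F.suc j)) ⟨
  (b₀ + B) + a (F.suc j)   ∎
  where
  open ≤-Reasoning
  b₀ = b F.zero
  A = sumℚ (λ i → a (F.suc i))
  B = sumℚ (λ i → b (F.suc i))

module _ {n} (s : Schedule n) where

  since-≤ : ∀ i t → since s i t ℕ.≤ t
  since-≤ i zero = ℕ.z≤n
  since-≤ i (suc t) with s t F.≟ i
  ... | yes _ = ℕ.z≤n
  ... | no  _ = ℕ.s≤s (since-≤ i t)

  since-cut : ∀ t → since s (s t) (suc t) ≡ 0
  since-cut t with s t F.≟ s t
  ... | yes _    = refl
  ... | no  st≢st = contradiction refl st≢st

  since-uncut : ∀ {i} t → s t ≢ i → since s i (suc t) ≡ suc (since s i t)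
  since-uncut {i} t st≢i with s t F.≟ i
  ... | yes st≡i = contradiction st≡i st≢i
  ... | no  _    = refl

  uncut-since-last-cut : ∀ i t {j} → j ℕ.< since s i t → s (t ℕ.∸ since s i t ℕ.+ j) ≢ i
  uncut-since-last-cut i zero ()
  uncut-since-last-cut i (suc t) {j} j<since with s t F.≟ i
  ... | yes _ = contradiction j<since ℕ.n≮0
  ... | no st≢i with ℕ.m<1+n⇒m<n∨m≡n j<since
  ...   | inj₁ j<since′ = uncut-since-last-cut i t j<since′
  ...   | inj₂ refl     = st≢i ∘ subst (λ u → s u ≡ i) (ℕ.m∸n+n≡m (since-≤ i t))

  pinwheel-since< : ∀ {f} → PinwheelSchedule f s → ∀ i t → since s i t ℕ.< f i
  pinwheel-since< {f} pinwheel i t with f i ℕ.≤? since s i t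
  ... | no  f≰since = ℕ.≰⇒> f≰since
  ... | yes f≤since with pinwheel i (t ℕ.∸ since s i t)
  ...   | j , j<f , cut = contradiction cut (uncut-since-last-cut i t (ℕ.<-≤-trans j<f f≤since))

module _ {n} (h : Fin n → ℚ) (s : Schedule n) where

  height : Fin n → ℕ → ℚ
  height i t = ℕtoℚ (since s i t) * h i

  heightBeforeCut : Fin n → ℕ → ℚ
  heightBeforeCut i t = ℕtoℚ (suc (since s i t)) * h i

  totalHeight : ℕ → ℚ
  totalHeight t = sumℚ (λ i → height i t)

  totalHeight-suc : ∀ t → totalHeight (suc t) + heightBeforeCut (s t) t ≡ totalHeight t + sumℚ h
  totalHeight-suc t = begin-equality
    totalHeight (suc t) + heightBeforeCut (s t) t           ≡⟨ sumℚ-update (s t) uncut ⟩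
    sumℚ (λ i → heightBeforeCut i t) + height (s t) (suc t) ≡⟨ cong₂ _+_ (sumℚ-cong λ i → ℕtoℚ-suc-* (since s i t) (h i)) cut ⟩
    sumℚ (λ i → height i t + h i) + 0ℚ                      ≡⟨ +-identityʳ _ ⟩
    sumℚ (λ i → height i t + h i)                           ≡⟨ sumℚ-+ (λ i → height i t) h ⟩
    totalHeight t + sumℚ h                                  ∎
    where
    open ≤-Reasoning
    uncut : ∀ i → i ≢ s t → height i (suc t) ≡ heightBeforeCut i t
    uncut i i≢st rewrite since-uncut s t (i≢st ∘ sym) = refl
    cut : height (s t) (suc t) ≡ 0ℚ
    cut rewrite since-cut s t = *-zeroˡ (h (s t))

  module _ (h≥0 : ∀ i → 0ℚ ≤ h i) {x} (MH≤x : MH≤ h s x) where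

    totalHeight≤n*x : ∀ t → totalHeight t ≤ ℕtoℚ n * x
    totalHeight≤n*x t = begin
      totalHeight t      ≤⟨ sumℚ-mono-≤ (λ i → ≤-trans (height≤heightBeforeCut i) (MH≤x i t)) ⟩
      sumℚ {n} (λ _ → x) ≡⟨ sumℚ-const n x ⟩
      ℕtoℚ n * x         ∎
      where
      open ≤-Reasoning
      height≤heightBeforeCut : ∀ i → height i t ≤ heightBeforeCut i t
      height≤heightBeforeCut i = *-monoʳ-≤-nonNeg (h i) {{nonNegative (h≥0 i)}} (ℕtoℚ-mono-≤ (ℕ.n≤1+n (since s i t)))

    t*H≤t*x+totalHeight : ∀ t → ℕtoℚ t * sumℚ h ≤ ℕtoℚ t * x + totalHeight t
    t*H≤t*x+totalHeight zero = begin
      0ℚ * sumℚ h             ≡⟨ *-zeroˡ (sumℚ h) ⟩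
      0ℚ                      ≤⟨ sumℚ-nonNeg {a = λ i → height i 0} (λ i → ≤-reflexive (sym (*-zeroˡ (h i)))) ⟩
      totalHeight 0           ≡⟨ +-identityˡ (totalHeight 0) ⟨
      0ℚ + totalHeight 0      ≡⟨ cong (_+ totalHeight 0) (*-zeroˡ x) ⟨
      0ℚ * x + totalHeight 0  ∎
      where open ≤-Reasoning
    t*H≤t*x+totalHeight (suc t) = begin
      ℕtoℚ (suc t) * H                                              ≡⟨ ℕtoℚ-suc-* t H ⟩
      ℕtoℚ t * H + H                                                ≤⟨ +-monoˡ-≤ H (t*H≤t*x+totalHeight t) ⟩
      ℕtoℚ t * x + totalHeight t + H                                ≡⟨ +-assoc (ℕtoℚ t * x) (totalHeight t) H ⟩
      ℕtoℚ t * x + (totalHeight t + H)                              ≡⟨ cong (_+_ (ℕtoℚ t * x)) (totalHeight-suc t) ⟨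
      ℕtoℚ t * x + (totalHeight (suc t) + heightBeforeCut (s t) t)  ≤⟨ +-monoʳ-≤ (ℕtoℚ t * x) (+-monoʳ-≤ (totalHeight (suc t)) (MH≤x (s t) t)) ⟩
      ℕtoℚ t * x + (totalHeight (suc t) + x)                        ≡⟨ solve 3 (λ tx Φ x → tx :+ (Φ :+ x) := (tx :+ x) :+ Φ) refl (ℕtoℚ t * x) (totalHeight (suc t)) x ⟩
      ℕtoℚ t * x + x + totalHeight (suc t)                          ≡⟨ cong (_+ totalHeight (suc t)) (ℕtoℚ-suc-* t x) ⟨
      ℕtoℚ (suc t) * x + totalHeight (suc t)                        ∎
      where
      open ≤-Reasoning
      H = sumℚ h

    sumℚ≤MH : sumℚ h ≤ x
    sumℚ≤MH = archimedean (ℕtoℚ n * x) λ t →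
      ≤-trans (t*H≤t*x+totalHeight t) (+-monoʳ-≤ (ℕtoℚ t * x) (totalHeight≤n*x t))

pinwheel-MH≤ : ∀ {n} {h : Fin n → ℚ} {f s c} → PinwheelSchedule f s → (∀ i → 0ℚ ≤ h i) →
               (∀ i → ℕtoℚ (f i) * h i ≤ c) → MH≤ h s c
pinwheel-MH≤ {h = h} pinwheel h≥0 fh≤c i t =
  ≤-trans (*-monoʳ-≤-nonNeg (h i) {{nonNegative (h≥0 i)}} (ℕtoℚ-mono-≤ (pinwheel-since< _ pinwheel i t)))
          (fh≤c i)

lemma1 : (n : ℕ) → 2 ℕ.≤ n → (h : Fin n → ℚ)
    → (∀ i → 0ℚ < h i)
    → (∀ i j → i F.≤ j → h j ≤ h i)
    → (δ : ℚ) → 0ℚ < δ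
    → (f : Fin n → ℕ) → (∀ i → 0 ℕ.< f i)
    → (∀ i → ℕtoℚ (f i) * h i ≤ (1ℚ + δ) * sumℚ h)
    → (s : Schedule n) → PinwheelSchedule f s
    → MH≤c*OPT h s (1ℚ + δ)
lemma1 n _ h h>0 _ δ δ>0 f _ fh≤ s pinwheel s′ x MH[s′]≤x =
  pinwheel-MH≤ pinwheel h≥0 λ i → ≤-trans (fh≤ i) (*-monoˡ-≤-nonNeg (1ℚ + δ) {{1+δ≥0}} H≤x)
  where
  h≥0 : ∀ i → 0ℚ ≤ h i
  h≥0 i = <⇒≤ (h>0 i)
  H≤x : sumℚ h ≤ x
  H≤x = sumℚ≤MH h s′ h≥0 MH[s′]≤x
  1+δ≥0 : NonNegative (1ℚ + δ)
  1+δ≥0 = pos⇒nonNeg (1ℚ + δ) {{pos+pos⇒pos 1ℚ δ {{positive δ>0}}}}
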